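{- The map $p\mapsto\operatorname{lab}^L(p)$ is a poset isomorphism from the set of $n$-symmetric lattice paths, ordered by $p\le q$ iff $p$ lies weakly below $q$, to the set of admissible subsets of $[\pm n]$ of cardinality $n$ with the type $C_n$ Gale order.
   Context: $[\pm n]=\{ -n,\dots,-1,1,\dots,n\}$ with the total order $-n<\dots<-1<1<\dots<n$. A subset $A\subseteq[\pm n]$ is admissible if $|A\cap\{i,-i\}|\le1$ for all $i$. Type $C_n$ Gale order on admissible $n$-subsets: $A=\{a_1<\dots<a_n\}\le B=\{b_1<\dots<b_n\}$ iff $a_i\le b_i$ for all $i$. An $n$-symmetric lattice path is a path from $(0,0)$ to $(n,n)$ of $2n$ unit steps $E=(1,0)$, $N=(0,1)$, a word $\alpha_1\cdots\alpha_{2n}$ with $\alpha_i\ne\alpha_{2n-i+1}$ for $i\le n$ (invariance under reflection through $y=n-x$). $\operatorname{lab}^L(p)$ is obtained by labelling the steps in order by $-n,-(n-1),\dots,-1,1,\dots,n$ and recording the labels of the $E$ steps. -}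

module Defs where

open import Data.Nat using (ℕ; zero; suc; _∸_; _<ᵇ_; _≤_)
open import Data.Integer using (ℤ; +_; -_) renaming (_≤_ to _≤ℤ_; _<_ to _<ℤ_)
open import Data.Fin using (Fin; toℕ; opposite)
open import Data.Vec using (Vec; lookup; toList)
open import Data.List using (List; []; _∷_; map; filter; allFin; take; length)
open import Data.List.Membership.Propositional using (_∈_)
open import Data.List.Relation.Unary.All using (All)
open import Data.List.Relation.Unary.AllPairs using (AllPairs)
open import Data.List.Relation.Binary.Pointwise using (Pointwise)
open import Data.Bool using (if_then_else_)
open import Data.Product using (Σ; _×_; _,_)
open import Relation.Binary.PropositionalEquality using (_≡_; _≢_)
open import Relation.Nullary using (¬_; Dec; yes; no)
open import Function.Bundles using (_⇔_)

data Step : Set where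
  E N : Step

_≟ₛ_ : (a b : Step) → Dec (a ≡ b)
E ≟ₛ E = yes _≡_.refl
E ≟ₛ N = no λ ()
N ≟ₛ E = no λ ()
N ≟ₛ N = yes _≡_.refl

Word : ℕ → Set
Word n = Vec Step (n Data.Nat.+ n)

-- n-symmetric: α_i ≠ α_{2n-i+1} for i ≤ n  (0-indexed: position k < n vs. 2n-1-k).
Symmetric : (n : ℕ) → Word n → Set
Symmetric n p = (k : Fin (n Data.Nat.+ n)) → suc (toℕ k) ≤ n → lookup p k ≢ lookup p (opposite k)

numN : List Step → ℕ
numN [] = zero
numN (E ∷ s) = numN s
numN (N ∷ s) = suc (numN s)

-- p lies weakly below q: after every number k of steps, p has height ≤ that of q.
Below : (n : ℕ) → Word n → Word n → Set
Below n p q = (k : ℕ) → numN (take k (toList p)) ≤ numN (take k (toList q))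

-- label of the step at (0-indexed) position k: -n, …, -1, 1, …, n
label : (n : ℕ) → Fin (n Data.Nat.+ n) → ℤ
label n k = if toℕ k <ᵇ n then - (+ (n ∸ toℕ k)) else + (suc (toℕ k) ∸ n)

signedRange : ℕ → List ℤ
signedRange n = map (label n) (allFin (n Data.Nat.+ n))

labL : (n : ℕ) → Word n → List ℤ
labL n p = map (label n) (filter (λ k → lookup p k ≟ₛ E) (allFin (n Data.Nat.+ n)))

-- A finite subset A = {a₁ < ⋯ < a_m} of [±n] is represented by its strictly
-- increasing enumeration (a₁, …, a_m).
-- Admissible subset of [±n] of cardinality n:
record AdmissibleN (n : ℕ) (A : List ℤ) : Set where
  field
    increasing : AllPairs _<ℤ_ A
    inRange    : All (_∈ signedRange n) A
    card       : length A ≡ n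
    admissible : (i : ℕ) → 1 ≤ i → i ≤ n → ¬ ((+ i ∈ A) × (- (+ i) ∈ A))

Gale : List ℤ → List ℤ → Set
Gale A B = Pointwise _≤ℤ_ A B

record IsPosetIso {X Y : Set} (P : X → Set) (Q : Y → Set)
                  (_≤X_ : X → X → Set) (_≤Y_ : Y → Y → Set) (f : X → Y) : Set₁ where
  field
    maps-into  : ∀ x → P x → Q (f x)
    injective  : ∀ x x' → P x → P x' → f x ≡ f x' → x ≡ x'
    surjective : ∀ y → Q y → Σ X λ x → P x × f x ≡ y
    order      : ∀ x x' → P x → P x' → (x ≤X x') ⇔ (f x ≤Y f x')

module Submission where

-- After t steps a path has height t minus the number of its E steps at positions < t, so
-- p lies below q iff for every t the path q has at most as many E steps before t as p; for two
-- increasing sequences of equal length this is the componentwise order of their E positions. The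
-- labelling is an order embedding of positions into ℤ that turns the reflection k ↦ 2n-1-k into
-- negation, so symmetry of p makes lab^L(p) admissible, and the reflection swaps E steps with N steps,
-- forcing exactly n of each. Conversely an admissible n-subset A is the label set of the word with
-- an E step at every label in A and an N step at every label whose negative is in A.

open import Defs
open import Data.Bool using (Bool; true; false; if_then_else_)
open import Data.Empty using (⊥-elim)
open import Data.Fin using (Fin; toℕ; opposite) renaming (suc to fsuc)
import Data.Fin.Properties as Fin
open import Data.Integer using (ℤ; +_; -_; -[1+_]; +<+; -<+; -<-) renaming (_≤_ to _≤ℤ_; _<_ to _<ℤ_)
import Data.Integer.Properties as ℤ
open import Data.List using (List; []; _∷_; map; filter; length; take; allFin; tabulate)
import Data.List.Properties as List
open import Data.List.Membership.Propositional using (_∈_)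
import Data.List.Membership.Propositional.Properties as Membership
open import Data.List.Membership.DecPropositional ℤ._≟_ using (_∈?_)
open import Data.List.Relation.Binary.Pointwise as Pointwise using (Pointwise; []; _∷_; Pointwise-≡⇒≡)
open import Data.List.Relation.Binary.Sublist.Heterogeneous using (Sublist; []; _∷_; _∷ʳ_)
open import Data.List.Relation.Binary.Sublist.Heterogeneous.Properties using (toPointwise)
open import Data.List.Relation.Binary.Subset.Propositional using (_⊆_)
open import Data.List.Relation.Unary.All as All using (All; []; _∷_)
import Data.List.Relation.Unary.All.Properties as All
open import Data.List.Relation.Unary.AllPairs as AllPairs using (AllPairs; []; _∷_)
import Data.List.Relation.Unary.AllPairs.Properties as AllPairs
open import Data.List.Relation.Unary.Any using (here; there; index; _─_)
import Data.List.Relation.Unary.Unique.Propositional.Properties as Unique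
open import Data.Nat using (ℕ; zero; suc; _∸_; _<ᵇ_; _≤_; _<_; _+_; _⊓_; ⌊_/2⌋; z≤n; s≤s; s<s; s≤s⁻¹; s<s⁻¹; _<?_; _≤?_)
import Data.Nat.Properties as ℕ
open import Data.Nat.Tactic.RingSolver using (solve-∀)
open import Data.Product using (Σ; _×_; _,_; proj₂)
open import Data.Sum using (_⊎_; inj₁; inj₂)
open import Data.Vec using (Vec; []; _∷_; lookup; toList)
import Data.Vec as Vec
import Data.Vec.Properties as Vec
open import Function using (_∘_; id; case_of_)
open import Function.Bundles using (_⇔_; mk⇔; Equivalence)
open import Function.Properties.Equivalence using () renaming (trans to ⇔-trans; sym to ⇔-sym)
open import Relation.Binary using (Rel; Irreflexive; Transitive)
open import Relation.Binary.PropositionalEquality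
open import Relation.Nullary using (¬_; does; yes; no)
open import Relation.Unary using (Pred; Decidable)

labelℕ : ℕ → ℕ → ℤ
labelℕ n j = if j <ᵇ n then - (+ (n ∸ j)) else + (suc j ∸ n)

data Side (n j : ℕ) : Set where
  left  : ∀ e → j + suc e ≡ n → Side n j
  right : ∀ d → n + d ≡ j → Side n j

side : ∀ n j → Side n j
side n j with j <? n
... | yes j<n = let (e , j+e≡n) = ℕ.m≤n⇒∃[o]m+o≡n j<n in left e (trans (ℕ.+-suc j e) j+e≡n)
... | no  j≮n = let (d , n+d≡j) = ℕ.m≤n⇒∃[o]m+o≡n (ℕ.≮⇒≥ j≮n) in right d n+d≡j

labelℕ-left : ∀ {n j e} → j + suc e ≡ n → labelℕ n j ≡ -[1+ e ]
labelℕ-left {j = j} {e} refl with j <ᵇ j + suc e | ℕ.<⇒<ᵇ (ℕ.m<m+n j {suc e} (s≤s z≤n))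
... | true | _ = cong (λ x → - (+ x)) (ℕ.m+n∸m≡n j (suc e))

labelℕ-right : ∀ {n j d} → n + d ≡ j → labelℕ n j ≡ + suc d
labelℕ-right {n} {d = d} refl with (n + d) <ᵇ n | ℕ.<ᵇ⇒< (n + d) n
... | false | _   = cong +_ (trans (cong (_∸ n) (sym (ℕ.+-suc n d))) (ℕ.m+n∸m≡n n (suc d)))
... | true  | n+d<n = ⊥-elim (ℕ.<⇒≱ (n+d<n _) (ℕ.m≤m+n n d))

labelℕ-strictMono : ∀ n {j k} → j < k → labelℕ n j <ℤ labelℕ n k
labelℕ-strictMono n {j} {k} j<k with side n j | side n k
... | left e ej | left e' ek = subst₂ _<ℤ_ (sym (labelℕ-left ej)) (sym (labelℕ-left ek))
  (-<- (ℕ.≰⇒> λ e≤e' → ℕ.<-irrefl refl (subst₂ _<_ ej ek (ℕ.+-mono-<-≤ j<k (s≤s e≤e')))))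
... | left e ej | right d' dk = subst₂ _<ℤ_ (sym (labelℕ-left ej)) (sym (labelℕ-right dk)) -<+
... | right d dj | left e' ek = ⊥-elim (ℕ.<-irrefl refl (ℕ.<-trans
  (ℕ.≤-<-trans (subst (n ≤_) dj (ℕ.m≤m+n n d)) j<k) (subst (k <_) ek (ℕ.m<m+n k (s≤s z≤n)))))
... | right d dj | right d' dk = subst₂ _<ℤ_ (sym (labelℕ-right dj)) (sym (labelℕ-right dk))
  (+<+ (s≤s (ℕ.+-cancelˡ-< n d d' (subst₂ _<_ (sym dj) (sym dk) j<k))))

labelℕ-mono-≤ : ∀ n {j k} → j ≤ k → labelℕ n j ≤ℤ labelℕ n k
labelℕ-mono-≤ n j≤k with ℕ.m≤n⇒m<n∨m≡n j≤k
... | inj₁ j<k  = ℤ.<⇒≤ (labelℕ-strictMono n j<k)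
... | inj₂ refl = ℤ.≤-refl

labelℕ-cancel-≤ : ∀ n {j k} → labelℕ n j ≤ℤ labelℕ n k → j ≤ k
labelℕ-cancel-≤ n lj≤lk = ℕ.≮⇒≥ λ k<j → ℤ.<⇒≱ (labelℕ-strictMono n k<j) lj≤lk

labelℕ-injective : ∀ n {j k} → labelℕ n j ≡ labelℕ n k → j ≡ k
labelℕ-injective n eq = ℕ.≤-antisym (labelℕ-cancel-≤ n (ℤ.≤-reflexive eq))
                                    (labelℕ-cancel-≤ n (ℤ.≤-reflexive (sym eq)))

labelℕ-reflect : ∀ n j r → r + suc j ≡ n + n → labelℕ n r ≡ - labelℕ n j
labelℕ-reflect n j r r+j≡2n with side n j
... | left e ej = trans (labelℕ-right (ℕ.+-cancelʳ-≡ (suc j) (n + e) r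
        (trans (shift₁ n e j) (trans (cong (λ x → n + x) ej) (sym r+j≡2n)))))
      (cong -_ (sym (labelℕ-left ej)))
  where
  shift₁ : ∀ n e j → (n + e) + suc j ≡ n + (j + suc e)
  shift₁ = solve-∀
... | right d dj = trans (labelℕ-left (ℕ.+-cancelʳ-≡ n (r + suc d) n
        (trans (sym (shift₂ r d n)) (trans (cong (λ x → r + suc x) dj) r+j≡2n))))
      (cong -_ (sym (labelℕ-right dj)))
  where
  shift₂ : ∀ r d n → r + suc (n + d) ≡ (r + suc d) + n
  shift₂ = solve-∀

labelℕ-range : ∀ n j → j < n + n →
               Σ ℕ λ i → suc i ≤ n × (labelℕ n j ≡ + suc i ⊎ labelℕ n j ≡ -[1+ i ])
labelℕ-range n j j<2n with side n j
... | left e ej  = e , subst (suc e ≤_) ej (ℕ.m≤n+m (suc e) j) , inj₂ (labelℕ-left ej)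
... | right d dj = d , ℕ.+-cancelˡ-< n d n (subst (_< n + n) (sym dj) j<2n) , inj₁ (labelℕ-right dj)

toℕ-opposite+suc : ∀ {m} (k : Fin m) → toℕ (opposite k) + suc (toℕ k) ≡ m
toℕ-opposite+suc k = trans (cong (_+ suc (toℕ k)) (Fin.opposite-prop k)) (ℕ.m∸n+n≡m (Fin.toℕ<n k))

label-opposite : ∀ n (k : Fin (n + n)) → label n (opposite k) ≡ - label n k
label-opposite n k = labelℕ-reflect n (toℕ k) (toℕ (opposite k)) (toℕ-opposite+suc k)

label-injective : ∀ n {j k : Fin (n + n)} → label n j ≡ label n k → j ≡ k
label-injective n eq = Fin.toℕ-injective (labelℕ-injective n eq)

countBelow : ℕ → List ℕ → ℕ
countBelow t xs = length (filter (_<? t) xs)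

countBelow-accept : ∀ {t x} xs → x < t → countBelow t (x ∷ xs) ≡ suc (countBelow t xs)
countBelow-accept xs x<t = cong length (List.filter-accept (_<? _) x<t)

countBelow-reject : ∀ {t x} xs → ¬ x < t → countBelow t (x ∷ xs) ≡ countBelow t xs
countBelow-reject xs x≮t = cong length (List.filter-reject (_<? _) x≮t)

countBelow-none : ∀ {t} xs → All (t ≤_) xs → countBelow t xs ≡ 0
countBelow-none xs t≤xs = cong length (List.filter-none (_<? _) (All.map ℕ.≤⇒≯ t≤xs))

countBelow-zero : ∀ xs → countBelow 0 xs ≡ 0
countBelow-zero xs = countBelow-none xs (All.universal (λ _ → z≤n) xs)

countBelow-map-suc : ∀ t ys → countBelow (suc t) (map suc ys) ≡ countBelow t ys
countBelow-map-suc t [] = refl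
countBelow-map-suc t (y ∷ ys) with y <? t
... | yes y<t = begin
  countBelow (suc t) (suc y ∷ map suc ys) ≡⟨ countBelow-accept (map suc ys) (s<s y<t) ⟩
  suc (countBelow (suc t) (map suc ys))   ≡⟨ cong suc (countBelow-map-suc t ys) ⟩
  suc (countBelow t ys)                   ≡⟨ countBelow-accept ys y<t ⟨
  countBelow t (y ∷ ys)                   ∎
  where open ≡-Reasoning
... | no y≮t = begin
  countBelow (suc t) (suc y ∷ map suc ys) ≡⟨ countBelow-reject (map suc ys) (y≮t ∘ s<s⁻¹) ⟩
  countBelow (suc t) (map suc ys)         ≡⟨ countBelow-map-suc t ys ⟩
  countBelow t ys                         ≡⟨ countBelow-reject ys y≮t ⟨
  countBelow t (y ∷ ys)                   ∎
  where open ≡-Reasoning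

countBelow-≤head : ∀ {t y} ys → All (y <_) ys → ¬ y < t → countBelow t (y ∷ ys) ≡ 0
countBelow-≤head {y = y} ys y<ys y≮t =
  countBelow-none (y ∷ ys) (t≤y ∷ All.map (λ y<z → ℕ.≤-trans t≤y (ℕ.<⇒≤ y<z)) y<ys)
  where t≤y = ℕ.≮⇒≥ y≮t

pointwise⇒countBelow-≥ : ∀ {xs ys} → AllPairs _<_ ys → Pointwise _≤_ xs ys →
                         ∀ t → countBelow t ys ≤ countBelow t xs
pointwise⇒countBelow-≥ [] [] t = z≤n
pointwise⇒countBelow-≥ {x ∷ xs} {y ∷ ys} (y<ys ∷ ys↑) (x≤y ∷ xs≤ys) t with y <? t
... | yes y<t = subst₂ _≤_ (sym (countBelow-accept ys y<t)) (sym (countBelow-accept xs (ℕ.≤-<-trans x≤y y<t)))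
                       (s≤s (pointwise⇒countBelow-≥ ys↑ xs≤ys t))
... | no  y≮t = subst (_≤ countBelow t (x ∷ xs)) (sym (countBelow-≤head ys y<ys y≮t)) z≤n

countBelow-≥⇒pointwise : ∀ {xs ys} → AllPairs _<_ xs → AllPairs _<_ ys → length xs ≡ length ys →
                         (∀ t → countBelow t ys ≤ countBelow t xs) → Pointwise _≤_ xs ys
countBelow-≥⇒pointwise {[]} {[]} _ _ _ _ = []
countBelow-≥⇒pointwise {x ∷ xs} {y ∷ ys} (x<xs ∷ xs↑) (y<ys ∷ ys↑) |xs|≡|ys| below≥ =
  x≤y ∷ countBelow-≥⇒pointwise xs↑ ys↑ (ℕ.suc-injective |xs|≡|ys|) tail≥
  where
  -- At threshold y + 1, ys has y below it, while x ∷ xs would have nothing if y < x.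
  x≤y : x ≤ y
  x≤y = ℕ.≮⇒≥ λ y<x → ℕ.n≮0 (subst₂ _≤_
    (countBelow-accept {x = y} ys ℕ.≤-refl) (countBelow-≤head {t = suc y} xs x<xs (ℕ.<⇒≱ y<x ∘ s≤s⁻¹))
    (below≥ (suc y)))
  tail≥ : ∀ t → countBelow t ys ≤ countBelow t xs
  tail≥ t with y <? t
  ... | yes y<t = s≤s⁻¹ (subst₂ _≤_ (countBelow-accept ys y<t) (countBelow-accept xs (ℕ.≤-<-trans x≤y y<t))
                                  (below≥ t))
  ... | no  y≮t = subst (_≤ countBelow t xs) (sym (countBelow-none ys
                    (All.map (λ y<z → ℕ.≤-trans (ℕ.≮⇒≥ y≮t) (ℕ.<⇒≤ y<z)) y<ys))) z≤n

pointwise⇔countBelow-≥ : ∀ {xs ys} → AllPairs _<_ xs → AllPairs _<_ ys → length xs ≡ length ys →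
                         Pointwise _≤_ xs ys ⇔ (∀ t → countBelow t ys ≤ countBelow t xs)
pointwise⇔countBelow-≥ xs↑ ys↑ |xs|≡|ys| =
  mk⇔ (pointwise⇒countBelow-≥ ys↑) (countBelow-≥⇒pointwise xs↑ ys↑ |xs|≡|ys|)

∈-─ : ∀ {a} {A : Set a} {x y : A} {ys} (x∈ys : x ∈ ys) → y ∈ ys → y ≢ x → y ∈ (ys ─ x∈ys)
∈-─ (here refl) (here refl) y≢x = ⊥-elim (y≢x refl)
∈-─ (here refl) (there y∈ys) _  = y∈ys
∈-─ (there _)   (here refl) _   = here refl
∈-─ (there x∈ys) (there y∈ys) y≢x = there (∈-─ x∈ys y∈ys y≢x)

unique-⊆⇒length-≤ : ∀ {a} {A : Set a} {xs ys : List A} → AllPairs _≢_ xs → xs ⊆ ys → length xs ≤ length ys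
unique-⊆⇒length-≤ {xs = []} _ _ = z≤n
unique-⊆⇒length-≤ {xs = x ∷ xs} {ys} (x≢xs ∷ xs!) xs⊆ys =
  subst (length (x ∷ xs) ≤_) (sym (List.length-removeAt′ ys (index x∈ys)))
    (s≤s (unique-⊆⇒length-≤ xs! λ y∈xs → ∈-─ x∈ys (xs⊆ys (there y∈xs)) λ y≡x → All.lookup x≢xs y∈xs (sym y≡x)))
  where x∈ys = xs⊆ys (here refl)

module _ {a ℓ} {A : Set a} {_<_ : Rel A ℓ} (irrefl : Irreflexive _≡_ _<_) (trans< : Transitive _<_) where

  sorted-⊆⇒sublist : ∀ {xs ys} → AllPairs _<_ xs → AllPairs _<_ ys → xs ⊆ ys → Sublist _≡_ xs ys
  sorted-⊆⇒sublist {[]} {[]} _ _ _ = []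
  sorted-⊆⇒sublist {[]} {y ∷ ys} _ (_ ∷ ys↑) _ = y ∷ʳ sorted-⊆⇒sublist [] ys↑ (λ ())
  sorted-⊆⇒sublist {x ∷ xs} {[]} _ _ xs⊆ys with xs⊆ys (here refl)
  ... | ()
  sorted-⊆⇒sublist {x ∷ xs} {y ∷ ys} (x<xs ∷ xs↑) (y<ys ∷ ys↑) xs⊆ys with xs⊆ys (here refl)
  ... | here refl = refl ∷ sorted-⊆⇒sublist xs↑ ys↑ λ z∈xs → drop-head (All.lookup x<xs z∈xs) (xs⊆ys (there z∈xs))
    where
    drop-head : ∀ {z} → x < z → z ∈ x ∷ ys → z ∈ ys
    drop-head x<z (here refl) = ⊥-elim (irrefl refl x<z)
    drop-head _   (there z∈ys) = z∈ys
  ... | there x∈ys = y ∷ʳ sorted-⊆⇒sublist (x<xs ∷ xs↑) ys↑ λ z∈xxs → drop-head z∈xxs (xs⊆ys z∈xxs)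
    where
    y<x : y < x
    y<x = All.lookup y<ys x∈ys
    drop-head : ∀ {z} → z ∈ x ∷ xs → z ∈ y ∷ ys → z ∈ ys
    drop-head (here refl)  (here refl) = ⊥-elim (irrefl refl y<x)
    drop-head (there z∈xs) (here refl) = ⊥-elim (irrefl refl (trans< y<x (All.lookup x<xs z∈xs)))
    drop-head _            (there z∈ys) = z∈ys

  sorted-⊆-length⇒≡ : ∀ {xs ys} → AllPairs _<_ xs → AllPairs _<_ ys → xs ⊆ ys →
                      length xs ≡ length ys → xs ≡ ys
  sorted-⊆-length⇒≡ xs↑ ys↑ xs⊆ys |xs|≡|ys| =
    Pointwise-≡⇒≡ (toPointwise |xs|≡|ys| (sorted-⊆⇒sublist xs↑ ys↑ xs⊆ys))

ePositions : ∀ {m} → Vec Step m → List ℕ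
ePositions []      = []
ePositions (E ∷ p) = 0 ∷ map suc (ePositions p)
ePositions (N ∷ p) = map suc (ePositions p)

-- After t steps, each of the first t ⊓ m steps is either N or an E at a position below t.
numN-take+countBelow : ∀ {m} t (p : Vec Step m) →
                       numN (take t (toList p)) + countBelow t (ePositions p) ≡ t ⊓ m
numN-take+countBelow zero    p       = countBelow-zero (ePositions p)
numN-take+countBelow (suc t) []      = refl
numN-take+countBelow (suc t) (E ∷ p) = begin
  numN (take t (toList p)) + countBelow (suc t) (0 ∷ map suc (ePositions p))
    ≡⟨ cong (λ c → numN (take t (toList p)) + c) (countBelow-accept (map suc (ePositions p)) (s≤s z≤n)) ⟩
  numN (take t (toList p)) + suc (countBelow (suc t) (map suc (ePositions p)))
    ≡⟨ ℕ.+-suc _ _ ⟩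
  suc (numN (take t (toList p)) + countBelow (suc t) (map suc (ePositions p)))
    ≡⟨ cong (λ c → suc (numN (take t (toList p)) + c)) (countBelow-map-suc t (ePositions p)) ⟩
  suc (numN (take t (toList p)) + countBelow t (ePositions p))
    ≡⟨ cong suc (numN-take+countBelow t p) ⟩
  suc (t ⊓ _) ∎
  where open ≡-Reasoning
numN-take+countBelow (suc t) (N ∷ p) = cong suc (begin
  numN (take t (toList p)) + countBelow (suc t) (map suc (ePositions p))
    ≡⟨ cong (λ c → numN (take t (toList p)) + c) (countBelow-map-suc t (ePositions p)) ⟩
  numN (take t (toList p)) + countBelow t (ePositions p)
    ≡⟨ numN-take+countBelow t p ⟩
  t ⊓ _ ∎)
  where open ≡-Reasoning

map-suc-sorted : ∀ {ys} → AllPairs _<_ ys → AllPairs _<_ (map suc ys)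
map-suc-sorted ys↑ = AllPairs.map⁺ (AllPairs.map s<s ys↑)

ePositions-sorted : ∀ {m} (p : Vec Step m) → AllPairs _<_ (ePositions p)
ePositions-sorted []      = []
ePositions-sorted (E ∷ p) =
  All.map⁺ (All.universal (λ _ → s≤s z≤n) (ePositions p)) ∷ map-suc-sorted (ePositions-sorted p)
ePositions-sorted (N ∷ p) = map-suc-sorted (ePositions-sorted p)

0∷≢map-suc : ∀ zs ws → 0 ∷ zs ≢ map suc ws
0∷≢map-suc zs []      ()
0∷≢map-suc zs (w ∷ ws) ()

ePositions-injective : ∀ {m} (p q : Vec Step m) → ePositions p ≡ ePositions q → p ≡ q
ePositions-injective []      []      _  = refl
ePositions-injective (E ∷ p) (E ∷ q) eq =
  cong (E ∷_) (ePositions-injective p q (List.map-injective ℕ.suc-injective (List.∷-injectiveʳ eq)))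
ePositions-injective (N ∷ p) (N ∷ q) eq =
  cong (N ∷_) (ePositions-injective p q (List.map-injective ℕ.suc-injective eq))
ePositions-injective (E ∷ p) (N ∷ q) eq = ⊥-elim (0∷≢map-suc _ _ eq)
ePositions-injective (N ∷ p) (E ∷ q) eq = ⊥-elim (0∷≢map-suc _ _ (sym eq))

positions : ∀ {m} → Vec Step m → Step → List (Fin m)
positions {m} p s = filter (λ k → lookup p k ≟ₛ s) (allFin m)

map-toℕ-filter-fsuc : ∀ {m ℓ} {P : Pred (Fin (suc m)) ℓ} (P? : Decidable P) (ks : List (Fin m)) →
                      map toℕ (filter P? (map fsuc ks)) ≡ map suc (map toℕ (filter (P? ∘ fsuc) ks))
map-toℕ-filter-fsuc P? [] = refl
map-toℕ-filter-fsuc P? (k ∷ ks) with P? (fsuc k)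
... | yes _ = cong (suc (toℕ k) ∷_) (map-toℕ-filter-fsuc P? ks)
... | no  _ = map-toℕ-filter-fsuc P? ks

map-toℕ-positions-∷ : ∀ {m} s (p : Vec Step m) →
  map toℕ (filter (λ k → lookup (s ∷ p) k ≟ₛ E) (tabulate fsuc)) ≡ map suc (map toℕ (positions p E))
map-toℕ-positions-∷ {m} s p = begin
  map toℕ (filter Q (tabulate fsuc))       ≡⟨ cong (map toℕ ∘ filter Q) (List.map-tabulate id fsuc) ⟨
  map toℕ (filter Q (map fsuc (allFin m))) ≡⟨ map-toℕ-filter-fsuc Q (allFin m) ⟩
  map suc (map toℕ (positions p E))        ∎
  where
  open ≡-Reasoning
  Q = λ k → lookup (s ∷ p) k ≟ₛ E

map-toℕ-positions : ∀ {m} (p : Vec Step m) → map toℕ (positions p E) ≡ ePositions p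
map-toℕ-positions []      = refl
map-toℕ-positions (E ∷ p) = cong (0 ∷_) (trans (map-toℕ-positions-∷ E p) (cong (map suc) (map-toℕ-positions p)))
map-toℕ-positions (N ∷ p) = trans (map-toℕ-positions-∷ N p) (cong (map suc) (map-toℕ-positions p))

other : Step → Step
other E = N
other N = E

≢⇒≡other : ∀ {x} s → x ≢ s → x ≡ other s
≢⇒≡other {E} E x≢s = ⊥-elim (x≢s refl)
≢⇒≡other {N} E _   = refl
≢⇒≡other {E} N _   = refl
≢⇒≡other {N} N x≢s = ⊥-elim (x≢s refl)

∈-positions⁻ : ∀ {m} (p : Vec Step m) {s k} → k ∈ positions p s → lookup p k ≡ s
∈-positions⁻ {m} p {s} k∈ = proj₂ (Membership.∈-filter⁻ (λ k → lookup p k ≟ₛ s) {xs = allFin m} k∈)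

∈-positions⁺ : ∀ {m} (p : Vec Step m) {s k} → lookup p k ≡ s → k ∈ positions p s
∈-positions⁺ p {s} {k} pₖ≡s = Membership.∈-filter⁺ (λ k → lookup p k ≟ₛ s) (Membership.∈-allFin k) pₖ≡s

length-positions-E+N : ∀ {m} (p : Vec Step m) → length (positions p E) + length (positions p N) ≡ m
length-positions-E+N {m} p = trans (split (allFin m)) (List.length-tabulate id)
  where
  split : ∀ ks → length (filter (λ k → lookup p k ≟ₛ E) ks) + length (filter (λ k → lookup p k ≟ₛ N) ks) ≡ length ks
  split [] = refl
  split (k ∷ ks) with lookup p k
  ... | E = cong suc (split ks)
  ... | N = trans (ℕ.+-suc _ _) (cong suc (split ks))

module _ {n : ℕ} (p : Word n) (symmetric : Symmetric n p) where

  opposite-≤ : ∀ (k : Fin (n + n)) → ¬ (suc (toℕ k) ≤ n) → suc (toℕ (opposite k)) ≤ n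
  opposite-≤ k k≰n = ℕ.≮⇒≥ λ n<opp → ℕ.<-irrefl (sym (toℕ-opposite+suc k))
    (ℕ.+-mono-≤-< (ℕ.≤-pred n<opp) (ℕ.≰⇒> k≰n))

  symmetric-everywhere : ∀ k → lookup p k ≢ lookup p (opposite k)
  symmetric-everywhere k with suc (toℕ k) ≤? n
  ... | yes k<n = symmetric k k<n
  ... | no  k≮n = λ eq → symmetric (opposite k) (opposite-≤ k k≮n)
                    (trans (sym eq) (cong (lookup p) (sym (Fin.opposite-involutive k))))

  opposite-∈-positions : ∀ s {k} → k ∈ positions p s → opposite k ∈ positions p (other s)
  opposite-∈-positions s {k} k∈ = ∈-positions⁺ p (≢⇒≡other s λ eq →
    symmetric-everywhere k (trans (∈-positions⁻ p k∈) (sym eq)))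

  length-positions-≤ : ∀ s → length (positions p s) ≤ length (positions p (other s))
  length-positions-≤ s = subst (_≤ length (positions p (other s))) (List.length-map opposite (positions p s))
    (unique-⊆⇒length-≤ (Unique.map⁺ opposite-injective (Unique.filter⁺ _ (Unique.allFin⁺ (n + n)))) opp⊆)
    where
    opposite-injective : ∀ {j k : Fin (n + n)} → opposite j ≡ opposite k → j ≡ k
    opposite-injective {j} {k} eq =
      trans (sym (Fin.opposite-involutive j)) (trans (cong opposite eq) (Fin.opposite-involutive k))
    opp⊆ : ∀ {k} → k ∈ map opposite (positions p s) → k ∈ positions p (other s)
    opp⊆ k∈ with Membership.∈-map⁻ opposite k∈
    ... | j , j∈ , refl = opposite-∈-positions s j∈

  length-positions-E : length (positions p E) ≡ n
  length-positions-E = begin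
    a                ≡⟨ ℕ.n≡⌊n+n/2⌋ a ⟩
    ⌊ a + a /2⌋      ≡⟨ cong (λ b → ⌊ a + b /2⌋) a≡b ⟩
    ⌊ a + b /2⌋      ≡⟨ cong ⌊_/2⌋ (length-positions-E+N p) ⟩
    ⌊ n + n /2⌋      ≡⟨ ℕ.n≡⌊n+n/2⌋ n ⟨
    n                ∎
    where
    open ≡-Reasoning
    a = length (positions p E)
    b = length (positions p N)
    a≡b : a ≡ b
    a≡b = ℕ.≤-antisym (length-positions-≤ E) (length-positions-≤ N)

labL-ePositions : ∀ n (p : Word n) → labL n p ≡ map (labelℕ n) (ePositions p)
labL-ePositions n p = trans (List.map-∘ (positions p E)) (cong (map (labelℕ n)) (map-toℕ-positions p))

length-ePositions : ∀ {n} (p : Word n) → Symmetric n p → length (ePositions p) ≡ n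
length-ePositions p symmetric = begin
  length (ePositions p)              ≡⟨ cong length (map-toℕ-positions p) ⟨
  length (map toℕ (positions p E))   ≡⟨ List.length-map toℕ (positions p E) ⟩
  length (positions p E)             ≡⟨ length-positions-E p symmetric ⟩
  _                                  ∎
  where open ≡-Reasoning

labL-sorted : ∀ n (p : Word n) → AllPairs _<ℤ_ (labL n p)
labL-sorted n p = subst (AllPairs _<ℤ_) (sym (labL-ePositions n p))
  (AllPairs.map⁺ (AllPairs.map (labelℕ-strictMono n) (ePositions-sorted p)))

labL-admissible : ∀ {n} (p : Word n) → Symmetric n p → ∀ i → ¬ ((+ i ∈ labL n p) × (- (+ i) ∈ labL n p))
labL-admissible {n} p symmetric i (+i∈ , -i∈)
  with Membership.∈-map⁻ (label n) +i∈ | Membership.∈-map⁻ (label n) -i∈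
... | k , k∈ , +i≡k | k' , k'∈ , -i≡k' =
  symmetric-everywhere p symmetric k' (trans (∈-positions⁻ p k'∈)
    (sym (trans (cong (lookup p) opposite-k'≡k) (∈-positions⁻ p k∈))))
  where
  opposite-k'≡k : opposite k' ≡ k
  opposite-k'≡k = label-injective n (begin
    label n (opposite k') ≡⟨ label-opposite n k' ⟩
    - label n k'          ≡⟨ cong -_ -i≡k' ⟨
    - - (+ i)             ≡⟨ ℤ.neg-involutive (+ i) ⟩
    + i                   ≡⟨ +i≡k ⟩
    label n k             ∎)
    where open ≡-Reasoning

labL-admissibleN : ∀ n (p : Word n) → Symmetric n p → AdmissibleN n (labL n p)
labL-admissibleN n p symmetric = record
  { increasing = labL-sorted n p
  ; inRange    = All.tabulate λ x∈ → case Membership.∈-map⁻ (label n) x∈ of λ where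
                   (k , _ , refl) → Membership.∈-map⁺ (label n) (Membership.∈-allFin k)
  ; card       = trans (cong length (labL-ePositions n p))
                   (trans (List.length-map (labelℕ n) (ePositions p)) (length-ePositions p symmetric))
  ; admissible = λ i _ _ → labL-admissible p symmetric i
  }

labL-injective : ∀ n (p q : Word n) → labL n p ≡ labL n q → p ≡ q
labL-injective n p q eq = ePositions-injective p q (List.map-injective (labelℕ-injective n)
  (trans (sym (labL-ePositions n p)) (trans eq (labL-ePositions n q))))

gale-map-labelℕ : ∀ n {xs ys} → Gale (map (labelℕ n) xs) (map (labelℕ n) ys) ⇔ Pointwise _≤_ xs ys
gale-map-labelℕ n = mk⇔
  (Pointwise.map (labelℕ-cancel-≤ n) ∘ Pointwise.map⁻ (labelℕ n) (labelℕ n))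
  (Pointwise.map⁺ (labelℕ n) (labelℕ n) ∘ Pointwise.map (labelℕ-mono-≤ n))

m+n≡o+p⇒[m≤o⇔p≤n] : ∀ {m n o p} → m + n ≡ o + p → m ≤ o ⇔ p ≤ n
m+n≡o+p⇒[m≤o⇔p≤n] eq = mk⇔
  (λ m≤o → ℕ.≮⇒≥ λ n<p → ℕ.<-irrefl eq (ℕ.+-mono-≤-< m≤o n<p))
  (λ p≤n → ℕ.≮⇒≥ λ o<m → ℕ.<-irrefl (sym eq) (ℕ.+-mono-<-≤ o<m p≤n))

below⇔countBelow-≥ : ∀ n (p q : Word n) →
                     Below n p q ⇔ (∀ t → countBelow t (ePositions q) ≤ countBelow t (ePositions p))
below⇔countBelow-≥ n p q = mk⇔
  (λ below t → Equivalence.to (swap t) (below t))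
  (λ counts t → Equivalence.from (swap t) (counts t))
  where
  swap : ∀ t → numN (take t (toList p)) ≤ numN (take t (toList q))
             ⇔ countBelow t (ePositions q) ≤ countBelow t (ePositions p)
  swap t = m+n≡o+p⇒[m≤o⇔p≤n] (trans (numN-take+countBelow t p) (sym (numN-take+countBelow t q)))

below⇔gale : ∀ n (p q : Word n) → Symmetric n p → Symmetric n q → Below n p q ⇔ Gale (labL n p) (labL n q)
below⇔gale n p q sp sq =
  subst₂ (λ A B → Below n p q ⇔ Gale A B) (sym (labL-ePositions n p)) (sym (labL-ePositions n q))
    (⇔-trans (below⇔countBelow-≥ n p q) (⇔-trans
      (⇔-sym (pointwise⇔countBelow-≥ (ePositions-sorted p) (ePositions-sorted q)
               (trans (length-ePositions p sp) (sym (length-ePositions q sq)))))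
      (⇔-sym (gale-map-labelℕ n))))

-- For an admissible A of size n the last alternative never fires (A meets every pair {i, -i}),
-- but it makes wordFor symmetric without counting.
stepFor : List ℤ → ℤ → Step
stepFor A x =
  if does (x ∈? A) then E else if does (- x ∈? A) then N else if isNegative x then N else E
  where
  isNegative : ℤ → Bool
  isNegative -[1+ _ ] = true
  isNegative (+ _)    = false

stepFor-∈ : ∀ {A x} → x ∈ A → stepFor A x ≡ E
stepFor-∈ {A} {x} x∈A with x ∈? A
... | yes _   = refl
... | no  x∉A = ⊥-elim (x∉A x∈A)

stepFor-± : ∀ A i → ¬ ((+ suc i ∈ A) × (-[1+ i ] ∈ A)) → stepFor A (+ suc i) ≢ stepFor A -[1+ i ]
stepFor-± A i admissible with + suc i ∈? A | -[1+ i ] ∈? A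
... | yes +i∈A | yes -i∈A = λ _ → admissible (+i∈A , -i∈A)
... | yes _    | no  _    = λ ()
... | no  _    | yes _    = λ ()
... | no  _    | no  _    = λ ()

wordFor : ∀ n → List ℤ → Word n
wordFor n A = Vec.tabulate (stepFor A ∘ label n)

module _ {n : ℕ} {A : List ℤ} (admissibleN : AdmissibleN n A) where
  open AdmissibleN admissibleN

  stepFor-≢-neg : ∀ j → j < n + n → stepFor A (labelℕ n j) ≢ stepFor A (- labelℕ n j)
  stepFor-≢-neg j j<2n with labelℕ-range n j j<2n
  ... | i , i<n , inj₁ eq rewrite eq = stepFor-± A i (admissible (suc i) (s≤s z≤n) i<n)
  ... | i , i<n , inj₂ eq rewrite eq = stepFor-± A i (admissible (suc i) (s≤s z≤n) i<n) ∘ sym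

  wordFor-symmetric : Symmetric n (wordFor n A)
  wordFor-symmetric k _ eq = stepFor-≢-neg (toℕ k) (Fin.toℕ<n k) (begin
    stepFor A (label n k)              ≡⟨ Vec.lookup∘tabulate (stepFor A ∘ label n) k ⟨
    lookup (wordFor n A) k             ≡⟨ eq ⟩
    lookup (wordFor n A) (opposite k)  ≡⟨ Vec.lookup∘tabulate (stepFor A ∘ label n) (opposite k) ⟩
    stepFor A (label n (opposite k))   ≡⟨ cong (stepFor A) (label-opposite n k) ⟩
    stepFor A (- label n k)            ∎)
    where open ≡-Reasoning

  ⊆-labL-wordFor : A ⊆ labL n (wordFor n A)
  ⊆-labL-wordFor x∈A with Membership.∈-map⁻ (label n) (All.lookup inRange x∈A)
  ... | k , _ , refl = Membership.∈-map⁺ (label n) (∈-positions⁺ (wordFor n A)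
    (trans (Vec.lookup∘tabulate (stepFor A ∘ label n) k) (stepFor-∈ x∈A)))

  labL-wordFor : labL n (wordFor n A) ≡ A
  labL-wordFor = sym (sorted-⊆-length⇒≡ ℤ.<-irrefl ℤ.<-trans increasing (labL-sorted n (wordFor n A))
    ⊆-labL-wordFor (trans card (sym (AdmissibleN.card (labL-admissibleN n (wordFor n A) wordFor-symmetric)))))

proposition2p11 : (n : ℕ) → IsPosetIso (Symmetric n) (AdmissibleN n) (Below n) Gale (labL n)
proposition2p11 n = record
  { maps-into  = labL-admissibleN n
  ; injective  = λ p q _ _ → labL-injective n p q
  ; surjective = λ A admissibleN → wordFor n A , wordFor-symmetric admissibleN , labL-wordFor admissibleN
  ; order      = below⇔gale n
  }
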